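{- Let $G=(V,E)$ be an undirected unweighted graph with $|V|=n$ whose edges $e_1,\dots,e_m$ are streamed in an arbitrary order, let $K\ge1$ be an integer, and consider an execution of the One-Pass Sparsifier (described in the context). For $1\le J\le LK$ with $J=(l,k)$, i.e. $J=K(l-1)+k$, let $X^J$ be the set of edges $e=(u,v)\in E$ such that $u$ and $v$ are connected in $D_{J-1}$ at the time $e$ arrives. Then with high probability $|E\setminus X^J|=O(K2^l n)$.
   Context: "With high probability" means with probability at least $1-n^{ -c}$ for a constant $c>0$. One-Pass Sparsifier: let $L=\lceil\log_2(2n)\rceil$, $\varepsilon>0$, $\rho=16(d+2)\ln n$ for a constant $d>0$. Maintain union–find connectivity structures $D_{l,k}$ on $V$ for $1\le l\le L$, $1\le k\le K$, initially with no edges; index them also by $J=K(l-1)+k\in\{1,\dots,LK\}$, and let $D_0$ be a structure in which all vertices are connected. For each edge $e$ and each $(l,k)$ let $A'_{l,k,e}$ be an independent Bernoulli variable with $\Pr[A'_{l,k,e}=1]=2^{ -l}$. When edge $e_t=(u_t,v_t)$ arrives: for $J=1,2,\dots,LK$ in increasing order (with $J=(l,k)$), add $e_t$ to $D_J$ if $A'_{l,k,e_t}=1$ and $u_t,v_t$ are currently connected in $D_{J-1}$. Then let $L'(e_t)$ be the minimum $l$ such that $u_t,v_t$ are not connected in $D_{l,K}$, set $z'(e_t)=\min\{1,4\rho/(\varepsilon^2 2^{L'(e_t)})\}$, and output $e_t$ with probability $z'(e_t)$, with weight $1/z'(e_t)$. -}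

module Defs where

open import Data.Nat as ℕ using (ℕ; zero; suc; _∸_; _≡ᵇ_; _<ᵇ_)
open import Data.Nat.Logarithm using (⌈log₂_⌉)
open import Data.Bool using (Bool; true; false; if_then_else_; _∧_)
open import Data.Fin using (Fin; toℕ)
open import Data.List using (List; []; _∷_; take; drop; replicate; concat; concatMap; map; length; upTo)
open import Data.List.Relation.Unary.All using (All)
open import Data.List.Relation.Unary.AllPairs using (AllPairs)
open import Data.Product using (_×_; _,_)
open import Data.Sum using (_⊎_)
open import Data.Integer using (+_)
open import Data.Rational using (ℚ; _*_; _+_; _-_; 1ℚ; 0ℚ; ½; _/_)
open import Relation.Binary.PropositionalEquality using (_≡_; _≢_)
open import Relation.Nullary using (¬_)
open import Function using (_∘_)

-- Graphs: vertex set V = Fin n; the stream is the list of edges e_1..e_m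
-- in arrival order.

Edge : ℕ → Set
Edge n = Fin n × Fin n

SameEdge : ∀ {n} → Edge n → Edge n → Set
SameEdge (u , v) (u' , v') = (u ≡ u' × v ≡ v') ⊎ (u ≡ v' × v ≡ u')

SimpleStream : ∀ {n} → List (Edge n) → Set
SimpleStream es = All (λ e → Data.Product.proj₁ e ≢ Data.Product.proj₂ e) es
                × AllPairs (λ e e' → ¬ SameEdge e e') es

Lparam : ℕ → ℕ
Lparam n = ⌈log₂ (2 ℕ.* n) ⌉

powℚ : ℚ → ℕ → ℚ
powℚ x zero = 1ℚ
powℚ x (suc k) = x * powℚ x k

ofℕ : ℕ → ℚ
ofℕ m = (+ m) / 1

-- Union–find connectivity structures, represented by component labels.
-- A state assigns to every index J ≥ 1 a labelling of the vertices of D_J;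
-- u, v are connected in D_J iff their labels agree.  D_0 is the
-- structure in which all vertices are connected.

State : ℕ → Set
State n = ℕ → Fin n → ℕ

initState : ∀ {n} → State n
initState J u = toℕ u

connected : ∀ {n} → State n → ℕ → Fin n → Fin n → Bool
connected S zero u v = true
connected S (suc j) u v = S (suc j) u ≡ᵇ S (suc j) v

addEdge : ∀ {n} → State n → ℕ → Fin n → Fin n → State n
addEdge S J u v J' w =
  if J' ≡ᵇ J
  then (if S J w ≡ᵇ S J v then S J u else S J w)
  else S J' w

-- processing of one arriving edge (u,v): the bits are A'_{J,e} for
-- J = j, j+1, …, LK (in increasing order); add e to D_J iff A'=1 and
-- u,v are currently connected in D_{J-1}.
processEdge : ∀ {n} → State n → Fin n → Fin n → (j : ℕ) → List Bool → State n
processEdge S u v j [] = S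
processEdge S u v j (b ∷ bs) =
  processEdge (if b ∧ connected S (j ∸ 1) u v then addEdge S j u v else S)
              u v (suc j) bs

-- |E ∖ X^J|: number of stream edges whose endpoints are NOT connected in
-- D_{J-1} at the time the edge arrives.  The random bits are a flat list,
-- LK bits per edge (in order J = 1..LK), edge after edge.
countNotX : ∀ {n} → (LK J : ℕ) → State n → List (Edge n) → List Bool → ℕ
countNotX LK J S [] bs = 0
countNotX LK J S ((u , v) ∷ es) bs =
  (if connected S (J ∸ 1) u v then 0 else 1)
  ℕ.+ countNotX LK J (processEdge S u v 1 (take LK bs)) es (drop LK bs)

-- Probability over independent Bernoulli bits: given the list of success
-- probabilities p_1,…,p_r, Pr ps f is the probability that f(b_1,…,b_r)
-- = true when b_i ~ Bernoulli(p_i) independently.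

Pr : List ℚ → (List Bool → Bool) → ℚ
Pr [] f = if f [] then 1ℚ else 0ℚ
Pr (p ∷ ps) f = p * Pr ps (f ∘ (true ∷_)) + (1ℚ - p) * Pr ps (f ∘ (false ∷_))

-- success probabilities of the bits A'_{l,k,e} of one edge, in order
-- J = K(l-1)+k = 1..LK:  Pr[A'_{l,k,e} = 1] = 2^{-l}
bitProbsEdge : (L K : ℕ) → List ℚ
bitProbsEdge L K = concatMap (λ i → replicate K (powℚ ½ (suc i))) (upTo L)

bitProbs : (L K m : ℕ) → List ℚ
bitProbs L K m = concat (replicate m (bitProbsEdge L K))

-- Probability (over the algorithm's randomness) that |E ∖ X^J| exceeds
-- C·K·2^l·n, for J = K(l-1)+k.
failProb : (n K C l k : ℕ) → List (Edge n) → ℚ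
failProb n K C l k es =
  Pr (bitProbs (Lparam n) K (length es))
     (λ bs → (C ℕ.* K ℕ.* (2 ℕ.^ l) ℕ.* n)
               <ᵇ countNotX (Lparam n ℕ.* K) (K ℕ.* (l ∸ 1) ℕ.+ k) initState es bs)

-- Fix J = K(l-1)+k, h = 2^-l and λ = 1 + h/2.  Give each structure D_i with i < J the
-- weight ν_i = 1 + 2^(l_i) h, where l_i ≤ l is the level of i, and take as potential
-- Φ = Π_{i<J} ν_i^(c_i), where c_i is the number of components of D_i.  While an edge is
-- processed, call an index j < J a trial if its endpoints are connected in D_{j-1} but not
-- in D_j; an edge outside X^J meets at least one trial.  A trial succeeds with probability
-- 2^(-l_j) and then merges two components of D_j, dividing Φ by ν_j, so λ^(#trials) Φ is a
-- supermartingale.  Hence E[λ^|E∖X^J|] ≤ Φ_init = (Π_{i<J} ν_i)^n ≤ 8^(Kn), because each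
-- level occurs K times and Π_{e≤l} (1 + 2^(e-l)) ≤ 6.  As λ^(2^(l+1)) ≥ 2 (Bernoulli),
-- λ^(8K 2^l n) ≥ 16^(Kn), and Markov's inequality gives
-- Pr[|E∖X^J| > 8K 2^l n] ≤ 2^(-Kn) ≤ 1/n.
module Submission where

open import Data.Bool using (Bool; true; false; if_then_else_; T; _∧_; not)
open import Data.Bool.Properties using (T-≡)
open import Function.Bundles using (Equivalence)
open import Data.Empty using (⊥-elim)
open import Data.Fin using (Fin; toℕ)
open import Data.List using (List; []; _∷_; _++_; [_]; length; map; take; drop; replicate; concatMap; upTo; applyUpTo; allFin)
open import Data.List.Relation.Unary.All using (All; []; _∷_; tabulate)
import Data.List.Relation.Unary.All.Properties as All
import Data.List.Properties as List
open import Data.Product using (Σ; _×_; _,_)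
open import Data.Sum using (_⊎_; inj₁; inj₂)
open import Data.Unit using (tt)
open import Function using (_∘_; id)
import Data.Nat as ℕ
import Data.Nat.Properties as ℕ
import Data.Integer as ℤ
import Data.Integer.Properties as ℤ
import Data.Rational as ℚ
import Data.Rational.Properties as ℚ
import Data.Rational.Unnormalised as ℚᵘ
import Data.Rational.Unnormalised.Properties as ℚᵘ
open import Data.Rational.Solver using (module +-*-Solver)
open import Relation.Binary.PropositionalEquality hiding ([_]; J)
open import Relation.Nullary using (yes; no)
open import Defs

open import Data.Nat using (ℕ; zero; suc; _∸_; _^_; z≤n; s≤s)

module Preliminaries where
  open import Data.Nat using (_≡ᵇ_; _≤_; _<_)
  open import Data.Nat.ListAction using (sum)
  open import Data.List.Membership.Propositional using (_∈_)
  open import Data.List.Relation.Unary.Any using (here; there)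

  take-++-∷ : ∀ {A : Set} (pre : List A) y ys m → length pre < m →
              take m (pre ++ y ∷ ys) ≡ pre ++ y ∷ take (m ∸ suc (length pre)) ys
  take-++-∷ []        y ys (suc m) _         = refl
  take-++-∷ (x ∷ pre) y ys (suc m) (s≤s lt) = cong (x ∷_) (take-++-∷ pre y ys m lt)

  length-take-≤ : ∀ {A : Set} m (xs : List A) → length (take m xs) ≤ m
  length-take-≤ m xs = ℕ.≤-trans (ℕ.≤-reflexive (List.length-take m xs)) (ℕ.m⊓n≤m m (length xs))

  take-length-++ : ∀ {A : Set} (xs ys : List A) {m} → length xs ≡ m → take m (xs ++ ys) ≡ xs
  take-length-++ []       ys refl = refl
  take-length-++ (x ∷ xs) ys refl = cong (x ∷_) (take-length-++ xs ys refl)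

  drop-length-++ : ∀ {A : Set} (xs ys : List A) {m} → length xs ≡ m → drop m (xs ++ ys) ≡ ys
  drop-length-++ []       ys refl = refl
  drop-length-++ (x ∷ xs) ys refl = drop-length-++ xs ys refl

  suc<⇒<∸1 : ∀ {m J} → suc m < J → m < J ∸ 1
  suc<⇒<∸1 {J = suc J} (s≤s lt) = lt

  <∸1⇒suc< : ∀ {m J} → m < J ∸ 1 → suc m < J
  <∸1⇒suc< {J = suc J} lt = s≤s lt

  take-length-+ : ∀ {A : Set} (ys : List A) m zs → take (length ys ℕ.+ m) (ys ++ zs) ≡ ys ++ take m zs
  take-length-+ []       m zs = refl
  take-length-+ (y ∷ ys) m zs = cong (y ∷_) (take-length-+ ys m zs)

  take-applyUpTo : ∀ {A : Set} (f : ℕ → A) {m L} → m ≤ L → take m (applyUpTo f L) ≡ applyUpTo f m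
  take-applyUpTo f z≤n       = refl
  take-applyUpTo f (s≤s m≤L) = cong (f 0 ∷_) (take-applyUpTo (f ∘ suc) m≤L)

  ≡ᵇ-true⇒≡ : ∀ {m k} → (m ≡ᵇ k) ≡ true → m ≡ k
  ≡ᵇ-true⇒≡ {m} {k} eq = ℕ.≡ᵇ⇒≡ m k (Equivalence.from T-≡ eq)

  ≡ᵇ-false⇒≢ : ∀ {m k} → (m ≡ᵇ k) ≡ false → m ≢ k
  ≡ᵇ-false⇒≢ {m} {k} eq m≡k = subst T eq (ℕ.≡⇒≡ᵇ m k m≡k)

  ≢⇒≡ᵇ-false : ∀ {m k} → m ≢ k → (m ≡ᵇ k) ≡ false
  ≢⇒≡ᵇ-false {m} {k} m≢k with m ≡ᵇ k in eq
  ... | true  = ⊥-elim (m≢k (≡ᵇ-true⇒≡ eq))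
  ... | false = refl

  ≡ᵇ-refl : ∀ m → (m ≡ᵇ m) ≡ true
  ≡ᵇ-refl zero    = refl
  ≡ᵇ-refl (suc m) = ≡ᵇ-refl m

  sum-map-mono : ∀ {A : Set} (xs : List A) {f g : A → ℕ} → (∀ x → f x ≤ g x) →
                 sum (map f xs) ≤ sum (map g xs)
  sum-map-mono []       f≤g = z≤n
  sum-map-mono (x ∷ xs) f≤g = ℕ.+-mono-≤ (f≤g x) (sum-map-mono xs f≤g)

  sum-map-mono-< : ∀ {A : Set} {xs : List A} {f g : A → ℕ} {y} → (∀ x → f x ≤ g x) →
                   y ∈ xs → f y < g y → sum (map f xs) < sum (map g xs)
  sum-map-mono-< {xs = x ∷ xs} f≤g (here refl) fy<gy = ℕ.+-mono-<-≤ fy<gy (sum-map-mono xs f≤g)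
  sum-map-mono-< {xs = x ∷ xs} f≤g (there y∈xs) fy<gy = ℕ.+-mono-≤-< (f≤g x) (sum-map-mono-< f≤g y∈xs fy<gy)

module Arithmetic where
  open import Data.Rational using (ℚ; 0ℚ; 1ℚ; ½; _+_; _*_; _-_; -_; _≤_; nonNegative; positive)
  open +-*-Solver

  0≤1 : 0ℚ ≤ 1ℚ
  0≤1 = ℚ.≤ᵇ⇒≤ tt

  *-monoˡ-≤-0≤ : ∀ {r p q} → 0ℚ ≤ r → p ≤ q → r * p ≤ r * q
  *-monoˡ-≤-0≤ {r} 0≤r = ℚ.*-monoˡ-≤-nonNeg r {{nonNegative 0≤r}}

  *-monoʳ-≤-0≤ : ∀ {r p q} → 0ℚ ≤ r → p ≤ q → p * r ≤ q * r
  *-monoʳ-≤-0≤ {r} 0≤r = ℚ.*-monoʳ-≤-nonNeg r {{nonNegative 0≤r}}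

  *-mono-≤-0≤ : ∀ {a b c d} → 0ℚ ≤ b → 0ℚ ≤ c → a ≤ b → c ≤ d → a * c ≤ b * d
  *-mono-≤-0≤ 0≤b 0≤c a≤b c≤d = ℚ.≤-trans (*-monoʳ-≤-0≤ 0≤c a≤b) (*-monoˡ-≤-0≤ 0≤b c≤d)

  *-0≤ : ∀ {a b} → 0ℚ ≤ a → 0ℚ ≤ b → 0ℚ ≤ a * b
  *-0≤ {a} 0≤a 0≤b = ℚ.≤-trans (ℚ.≤-reflexive (sym (ℚ.*-zeroʳ a))) (*-monoˡ-≤-0≤ 0≤a 0≤b)

  1≤1+x : ∀ {x} → 0ℚ ≤ x → 1ℚ ≤ 1ℚ + x
  1≤1+x 0≤x = ℚ.≤-trans (ℚ.≤-reflexive (sym (ℚ.+-identityʳ 1ℚ))) (ℚ.+-monoʳ-≤ 1ℚ 0≤x)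

  0≤1-p : ∀ {p} → p ≤ 1ℚ → 0ℚ ≤ 1ℚ - p
  0≤1-p {p} p≤1 = ℚ.≤-trans (ℚ.≤-reflexive (sym (ℚ.+-inverseʳ p))) (ℚ.+-monoˡ-≤ (- p) p≤1)

  powℚ-0≤ : ∀ {x} n → 0ℚ ≤ x → 0ℚ ≤ powℚ x n
  powℚ-0≤ zero    0≤x = 0≤1
  powℚ-0≤ (suc n) 0≤x = *-0≤ 0≤x (powℚ-0≤ n 0≤x)

  powℚ-1≤ : ∀ {x} n → 1ℚ ≤ x → 1ℚ ≤ powℚ x n
  powℚ-1≤ zero    1≤x = ℚ.≤-refl
  powℚ-1≤ (suc n) 1≤x = *-mono-≤-0≤ (ℚ.≤-trans 0≤1 1≤x) 0≤1 1≤x (powℚ-1≤ n 1≤x)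

  powℚ-≤1 : ∀ {x} n → 0ℚ ≤ x → x ≤ 1ℚ → powℚ x n ≤ 1ℚ
  powℚ-≤1 zero    0≤x x≤1 = ℚ.≤-refl
  powℚ-≤1 (suc n) 0≤x x≤1 = *-mono-≤-0≤ 0≤1 (powℚ-0≤ n 0≤x) x≤1 (powℚ-≤1 n 0≤x x≤1)

  powℚ-1ℚ : ∀ n → powℚ 1ℚ n ≡ 1ℚ
  powℚ-1ℚ zero    = refl
  powℚ-1ℚ (suc n) = cong (1ℚ *_) (powℚ-1ℚ n)

  powℚ-+ : ∀ x a b → powℚ x (a ℕ.+ b) ≡ powℚ x a * powℚ x b
  powℚ-+ x zero    b = sym (ℚ.*-identityˡ _)
  powℚ-+ x (suc a) b = trans (cong (x *_) (powℚ-+ x a b)) (sym (ℚ.*-assoc x _ _))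

  powℚ-distrib-* : ∀ x y n → powℚ (x * y) n ≡ powℚ x n * powℚ y n
  powℚ-distrib-* x y zero    = refl
  powℚ-distrib-* x y (suc n) rewrite powℚ-distrib-* x y n =
    solve 4 (λ x y a b → (x :* y) :* (a :* b) := (x :* a) :* (y :* b)) refl x y (powℚ x n) (powℚ y n)

  powℚ-* : ∀ x a b → powℚ x (a ℕ.* b) ≡ powℚ (powℚ x a) b
  powℚ-* x zero    b = sym (powℚ-1ℚ b)
  powℚ-* x (suc a) b = begin
    powℚ x (b ℕ.+ a ℕ.* b)             ≡⟨ powℚ-+ x b (a ℕ.* b) ⟩
    powℚ x b * powℚ x (a ℕ.* b)        ≡⟨ cong (powℚ x b *_) (powℚ-* x a b) ⟩
    powℚ x b * powℚ (powℚ x a) b       ≡⟨ powℚ-distrib-* x (powℚ x a) b ⟨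
    powℚ (x * powℚ x a) b              ∎
    where open ≡-Reasoning

  powℚ-monoʳ-≤ : ∀ {x a b} → 1ℚ ≤ x → a ℕ.≤ b → powℚ x a ≤ powℚ x b
  powℚ-monoʳ-≤ {x} {a} 1≤x a≤b with ℕ.m≤n⇒∃[o]m+o≡n a≤b
  ... | o , refl = begin
    powℚ x a          ≡⟨ ℚ.*-identityʳ _ ⟨
    powℚ x a * 1ℚ     ≤⟨ *-monoˡ-≤-0≤ (powℚ-0≤ a (ℚ.≤-trans 0≤1 1≤x)) (powℚ-1≤ o 1≤x) ⟩
    powℚ x a * powℚ x o ≡⟨ powℚ-+ x a o ⟨
    powℚ x (a ℕ.+ o)  ∎
    where open ℚ.≤-Reasoning

  powℚ-monoˡ-≤ : ∀ {x y} n → 0ℚ ≤ x → x ≤ y → powℚ x n ≤ powℚ y n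
  powℚ-monoˡ-≤ zero    0≤x x≤y = ℚ.≤-refl
  powℚ-monoˡ-≤ (suc n) 0≤x x≤y =
    *-mono-≤-0≤ (ℚ.≤-trans 0≤x x≤y) (powℚ-0≤ n 0≤x) x≤y (powℚ-monoˡ-≤ n 0≤x x≤y)

  two : ℚ
  two = 1ℚ + 1ℚ

  0≤½ : 0ℚ ≤ ½
  0≤½ = ℚ.≤ᵇ⇒≤ tt

  ½≤1 : ½ ≤ 1ℚ
  ½≤1 = ℚ.≤ᵇ⇒≤ tt

  1≤two : 1ℚ ≤ two
  1≤two = ℚ.≤ᵇ⇒≤ tt

  0≤two : 0ℚ ≤ two
  0≤two = ℚ.≤ᵇ⇒≤ tt

  ½^e*2^e≡1 : ∀ e → powℚ ½ e * powℚ two e ≡ 1ℚ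
  ½^e*2^e≡1 zero    = refl
  ½^e*2^e≡1 (suc e) = begin
    (½ * powℚ ½ e) * (two * powℚ two e)
      ≡⟨ solve 4 (λ h t a b → (h :* a) :* (t :* b) := (h :* t) :* (a :* b)) refl ½ two (powℚ ½ e) (powℚ two e) ⟩
    (½ * two) * (powℚ ½ e * powℚ two e)
      ≡⟨ cong (1ℚ *_) (½^e*2^e≡1 e) ⟩
    1ℚ ∎
    where open ≡-Reasoning

  2^e*½^l≤1 : ∀ {e l} → e ℕ.≤ l → powℚ two e * powℚ ½ l ≤ 1ℚ
  2^e*½^l≤1 {e} e≤l with ℕ.m≤n⇒∃[o]m+o≡n e≤l
  ... | d , refl = begin
    powℚ two e * powℚ ½ (e ℕ.+ d)
      ≡⟨ cong (powℚ two e *_) (powℚ-+ ½ e d) ⟩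
    powℚ two e * (powℚ ½ e * powℚ ½ d)
      ≡⟨ solve 3 (λ t a b → t :* (a :* b) := (a :* t) :* b) refl (powℚ two e) (powℚ ½ e) (powℚ ½ d) ⟩
    (powℚ ½ e * powℚ two e) * powℚ ½ d
      ≡⟨ cong (_* powℚ ½ d) (½^e*2^e≡1 e) ⟩
    1ℚ * powℚ ½ d
      ≤⟨ *-monoˡ-≤-0≤ 0≤1 (powℚ-≤1 d 0≤½ ½≤1) ⟩
    1ℚ * 1ℚ ∎
    where open ℚ.≤-Reasoning

  -- ofℕ m is fromℚᵘ (mkℚᵘ (+ m) 0) by definition, so the identity is proved in ℚᵘ.
  ofℕ-suc : ∀ m → ofℕ (suc m) ≡ 1ℚ + ofℕ m
  ofℕ-suc m = trans (ℚ.fromℚᵘ-cong (ℚᵘ.≃-trans sucᵘ (ℚᵘ.≃-sym homo))) (ℚ.fromℚᵘ-toℚᵘ _)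
    where
    sucᵘ : ℚᵘ.mkℚᵘ (ℤ.+ suc m) 0 ℚᵘ.≃ ℚᵘ.1ℚᵘ ℚᵘ.+ ℚᵘ.mkℚᵘ (ℤ.+ m) 0
    sucᵘ = ℚᵘ.*≡* (trans (ℤ.*-identityʳ _) (sym (trans (ℤ.*-identityʳ _)
             (cong (ℤ._+_ (ℤ.+ 1)) (trans (ℤ.+◃n≡+n _) (cong ℤ.+_ (ℕ.*-identityʳ m)))))))
    homo : ℚ.toℚᵘ (1ℚ + ofℕ m) ℚᵘ.≃ ℚᵘ.1ℚᵘ ℚᵘ.+ ℚᵘ.mkℚᵘ (ℤ.+ m) 0
    homo = ℚᵘ.≃-trans (ℚ.toℚᵘ-homo-+ 1ℚ (ofℕ m)) (ℚᵘ.+-congʳ (ℚ.toℚᵘ 1ℚ) (ℚ.toℚᵘ-fromℚᵘ (ℚᵘ.mkℚᵘ (ℤ.+ m) 0)))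

  ofℕ≤2^ : ∀ m → ofℕ m ≤ powℚ two m
  ofℕ≤2^ zero    = 0≤1
  ofℕ≤2^ (suc m) = begin
    ofℕ (suc m)               ≡⟨ ofℕ-suc m ⟩
    1ℚ + ofℕ m                ≤⟨ ℚ.+-mono-≤ (powℚ-1≤ m 1≤two) (ofℕ≤2^ m) ⟩
    powℚ two m + powℚ two m   ≡⟨ solve 1 (λ X → X :+ X := (con 1ℚ :+ con 1ℚ) :* X) refl (powℚ two m) ⟩
    two * powℚ two m          ∎
    where open ℚ.≤-Reasoning

  bernoulli-pow2 : ∀ {x} a → 0ℚ ≤ x → 1ℚ + powℚ two a * x ≤ powℚ (1ℚ + x) (2 ^ a)
  bernoulli-pow2 {x} zero    0≤x = ℚ.≤-reflexive (solve 1 (λ x → con 1ℚ :+ con 1ℚ :* x := (con 1ℚ :+ x) :* con 1ℚ) refl x)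
  bernoulli-pow2 {x} (suc a) 0≤x = begin
    1ℚ + powℚ two (suc a) * x
      ≡⟨ cong (1ℚ +_) (ℚ.*-assoc two (powℚ two a) x) ⟩
    1ℚ + two * y
      ≤⟨ ℚ.≤-trans (ℚ.≤-reflexive (sym (ℚ.+-identityʳ _))) (ℚ.+-monoʳ-≤ (1ℚ + two * y) (*-0≤ 0≤y 0≤y)) ⟩
    1ℚ + two * y + y * y
      ≡⟨ solve 1 (λ y → con 1ℚ :+ (con 1ℚ :+ con 1ℚ) :* y :+ y :* y := (con 1ℚ :+ y) :* (con 1ℚ :+ y)) refl y ⟩
    (1ℚ + y) * (1ℚ + y)
      ≤⟨ *-mono-≤-0≤ 0≤q (ℚ.≤-trans 0≤1 (1≤1+x 0≤y)) ih ih ⟩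
    q * q
      ≡⟨ cong (λ e → q * powℚ (1ℚ + x) e) (ℕ.+-identityʳ (2 ^ a)) ⟨
    q * powℚ (1ℚ + x) (2 ^ a ℕ.+ 0)
      ≡⟨ powℚ-+ (1ℚ + x) (2 ^ a) (2 ^ a ℕ.+ 0) ⟨
    powℚ (1ℚ + x) (2 ^ suc a) ∎
    where
    open ℚ.≤-Reasoning
    y = powℚ two a * x
    0≤y : 0ℚ ≤ y
    0≤y = *-0≤ (powℚ-0≤ a 0≤two) 0≤x
    q = powℚ (1ℚ + x) (2 ^ a)
    ih : 1ℚ + y ≤ q
    ih = bernoulli-pow2 a 0≤x
    0≤q : 0ℚ ≤ q
    0≤q = ℚ.≤-trans (ℚ.≤-trans 0≤1 (1≤1+x 0≤y)) ih

  four : ℚ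
  four = two * two

  eight : ℚ
  eight = powℚ two 3

  [1+4y][1+2y]≤1+8y : ∀ {y} → 0ℚ ≤ y → four * y ≤ 1ℚ → (1ℚ + four * y) * (1ℚ + two * y) ≤ 1ℚ + four * (two * y)
  [1+4y][1+2y]≤1+8y {y} 0≤y 4y≤1 = begin
    (1ℚ + four * y) * (1ℚ + two * y)      ≡⟨ solve 1 (λ y → (con 1ℚ :+ c4 :* y) :* (con 1ℚ :+ c2 :* y)
                                                       := con 1ℚ :+ c4 :* (c2 :* y) :- (c2 :* y) :* (con 1ℚ :- c4 :* y)) refl y ⟩
    1ℚ + four * (two * y) - slack
      ≤⟨ ℚ.+-monoʳ-≤ (1ℚ + four * (two * y)) (ℚ.neg-antimono-≤ 0≤slack) ⟩
    1ℚ + four * (two * y) - 0ℚ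
      ≡⟨ ℚ.+-identityʳ _ ⟩
    1ℚ + four * (two * y) ∎
    where
    open ℚ.≤-Reasoning
    c2 = con 1ℚ :+ con 1ℚ
    c4 = c2 :* c2
    slack = (two * y) * (1ℚ - four * y)
    0≤slack : 0ℚ ≤ slack
    0≤slack = *-0≤ (*-0≤ 0≤two 0≤y) (0≤1-p 4y≤1)

  prodℚ : List ℚ → ℚ
  prodℚ = Data.List.foldr _*_ 1ℚ

  prodℚ-++ : ∀ xs ys → prodℚ (xs ++ ys) ≡ prodℚ xs * prodℚ ys
  prodℚ-++ []       ys = sym (ℚ.*-identityˡ _)
  prodℚ-++ (x ∷ xs) ys = trans (cong (x *_) (prodℚ-++ xs ys)) (sym (ℚ.*-assoc x _ _))

  prodℚ-replicate : ∀ k x → prodℚ (replicate k x) ≡ powℚ x k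
  prodℚ-replicate zero    x = refl
  prodℚ-replicate (suc k) x = cong (x *_) (prodℚ-replicate k x)

  1≤prodℚ : ∀ {xs} → All (1ℚ ≤_) xs → 1ℚ ≤ prodℚ xs
  1≤prodℚ []          = ℚ.≤-refl
  1≤prodℚ (1≤x ∷ 1≤xs) = *-mono-≤-0≤ (ℚ.≤-trans 0≤1 1≤x) 0≤1 1≤x (1≤prodℚ 1≤xs)

  prodℚ-take-≤ : ∀ m {xs} → All (1ℚ ≤_) xs → prodℚ (take m xs) ≤ prodℚ xs
  prodℚ-take-≤ zero    1≤xs          = 1≤prodℚ 1≤xs
  prodℚ-take-≤ (suc m) []            = ℚ.≤-refl
  prodℚ-take-≤ (suc m) (1≤x ∷ 1≤xs) = *-monoˡ-≤-0≤ (ℚ.≤-trans 0≤1 1≤x) (prodℚ-take-≤ m 1≤xs)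

  -- One trial of the supermartingale argument: it succeeds with probability p and then
  -- divides the potential by 1 + T h, while the factor 1 + h/2 is paid in either case.
  trial-supermartingale : ∀ {p T h Φ₁ Φ} → 0ℚ ≤ p → 0ℚ ≤ T → p * T ≡ 1ℚ → 0ℚ ≤ h → T * h ≤ 1ℚ →
    0ℚ ≤ Φ → Φ₁ * (1ℚ + T * h) ≤ Φ →
    p * ((1ℚ + h * ½) * Φ₁) + (1ℚ - p) * ((1ℚ + h * ½) * Φ) ≤ Φ
  trial-supermartingale {p} {T} {h} {Φ₁} {Φ} 0≤p 0≤T pT≡1 0≤h Th≤1 0≤Φ Φ₁ν≤Φ =
    ℚ.*-cancelˡ-≤-pos ν {{positive (ℚ.<-≤-trans (ℚ.positive⁻¹ 1ℚ) (1≤1+x 0≤x))}} (begin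
      ν * (p * (λ′ * Φ₁) + (1ℚ - p) * (λ′ * Φ))
        ≡⟨ solve 5 (λ ν p l R P → ν :* (p :* (l :* R) :+ (con 1ℚ :- p) :* (l :* P)) := (p :* l) :* (R :* ν) :+ ((con 1ℚ :- p) :* l :* ν) :* P) refl ν p λ′ Φ₁ Φ ⟩
      (p * λ′) * (Φ₁ * ν) + ((1ℚ - p) * λ′ * ν) * Φ
        ≤⟨ ℚ.+-monoˡ-≤ _ (*-monoˡ-≤-0≤ (*-0≤ 0≤p (ℚ.≤-trans 0≤1 (1≤1+x (*-0≤ 0≤h 0≤½)))) Φ₁ν≤Φ) ⟩
      (p * λ′) * Φ + ((1ℚ - p) * λ′ * ν) * Φ
        ≡⟨ solve 5 (λ ν p l R P → (p :* l) :* P :+ ((con 1ℚ :- p) :* l :* ν) :* P := (l :* (p :+ (con 1ℚ :- p) :* ν)) :* P) refl ν p λ′ Φ₁ Φ ⟩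
      (λ′ * (p + (1ℚ - p) * ν)) * Φ
        ≡⟨ cong (λ z → (λ′ * z) * Φ) failure-mass ⟩
      (λ′ * (1ℚ + x - h)) * Φ
        ≤⟨ *-monoʳ-≤-0≤ 0≤Φ λ′[1+x-h]≤ν ⟩
      ν * Φ ∎)
    where
    open ℚ.≤-Reasoning
    x = T * h
    ν = 1ℚ + x
    λ′ = 1ℚ + h * ½
    0≤x : 0ℚ ≤ x
    0≤x = *-0≤ 0≤T 0≤h
    failure-mass : p + (1ℚ - p) * ν ≡ 1ℚ + x - h
    failure-mass = begin-equality
      p + (1ℚ - p) * ν
        ≡⟨ solve 4 (λ p T h q → p :+ (con 1ℚ :- p) :* (con 1ℚ :+ T :* h) := con 1ℚ :+ T :* h :- (p :* T) :* h) refl p T h (1ℚ - p) ⟩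
      1ℚ + x - (p * T) * h
        ≡⟨ cong (λ z → 1ℚ + x - z * h) pT≡1 ⟩
      1ℚ + x - 1ℚ * h
        ≡⟨ cong (λ z → 1ℚ + x - z) (ℚ.*-identityˡ h) ⟩
      1ℚ + x - h ∎
    λ′[1+x-h]≤ν : λ′ * (1ℚ + x - h) ≤ ν
    λ′[1+x-h]≤ν = begin
      λ′ * (1ℚ + x - h)
        ≡⟨ solve 3 (λ h x y → (con 1ℚ :+ h :* con ½) :* y := y :+ (h :* con ½) :* y) refl h x (1ℚ + x - h) ⟩
      (1ℚ + x - h) + (h * ½) * (1ℚ + x - h)
        ≤⟨ ℚ.+-monoʳ-≤ (1ℚ + x - h) (*-monoˡ-≤-0≤ (*-0≤ 0≤h 0≤½) 1+x-h≤2) ⟩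
      (1ℚ + x - h) + (h * ½) * two
        ≡⟨ solve 2 (λ x h → (con 1ℚ :+ x :- h) :+ (h :* con ½) :* (con 1ℚ :+ con 1ℚ) := con 1ℚ :+ x) refl x h ⟩
      ν ∎
      where
      1+x-h≤2 : 1ℚ + x - h ≤ two
      1+x-h≤2 = ℚ.≤-trans (ℚ.+-monoʳ-≤ (1ℚ + x) (ℚ.neg-antimono-≤ 0≤h))
              (ℚ.≤-trans (ℚ.≤-reflexive (ℚ.+-identityʳ (1ℚ + x))) (ℚ.+-monoʳ-≤ 1ℚ Th≤1))

module Expectation where
  open import Data.Rational using (ℚ; 0ℚ; 1ℚ; ½; _+_; _*_; _-_; _≤_)
  open Arithmetic
  open +-*-Solver

  Ex : List ℚ → (List Bool → ℚ) → ℚ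
  Ex []       f = f []
  Ex (p ∷ ps) f = p * Ex ps (f ∘ (true ∷_)) + (1ℚ - p) * Ex ps (f ∘ (false ∷_))

  Probabilities : List ℚ → Set
  Probabilities = All (λ p → 0ℚ ≤ p × p ≤ 1ℚ)

  indicator : Bool → ℚ
  indicator b = if b then 1ℚ else 0ℚ

  Pr≡Ex-indicator : ∀ ps f → Pr ps f ≡ Ex ps (indicator ∘ f)
  Pr≡Ex-indicator []       f = refl
  Pr≡Ex-indicator (p ∷ ps) f =
    cong₂ (λ a b → p * a + (1ℚ - p) * b) (Pr≡Ex-indicator ps _) (Pr≡Ex-indicator ps _)

  Ex-cong : ∀ ps {f g} → (∀ bs → f bs ≡ g bs) → Ex ps f ≡ Ex ps g
  Ex-cong []       f≗g = f≗g []
  Ex-cong (p ∷ ps) f≗g = cong₂ (λ a b → p * a + (1ℚ - p) * b)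
    (Ex-cong ps (f≗g ∘ (true ∷_))) (Ex-cong ps (f≗g ∘ (false ∷_)))

  Ex-*ˡ : ∀ ps c f → Ex ps (λ bs → c * f bs) ≡ c * Ex ps f
  Ex-*ˡ []       c f = refl
  Ex-*ˡ (p ∷ ps) c f rewrite Ex-*ˡ ps c (f ∘ (true ∷_)) | Ex-*ˡ ps c (f ∘ (false ∷_)) =
    solve 5 (λ p q c a b → p :* (c :* a) :+ q :* (c :* b) := c :* (p :* a :+ q :* b)) refl p (1ℚ - p) c _ _

  Ex-++ : ∀ ps qs F → Ex (ps ++ qs) F ≡ Ex ps (λ as → Ex qs (λ bs → F (as ++ bs)))
  Ex-++ []       qs F = refl
  Ex-++ (p ∷ ps) qs F = cong₂ (λ a b → p * a + (1ℚ - p) * b) (Ex-++ ps qs _) (Ex-++ ps qs _)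

  Ex-mono : ∀ {ps f g} → Probabilities ps → (∀ bs → length bs ≡ length ps → f bs ≤ g bs) →
            Ex ps f ≤ Ex ps g
  Ex-mono {[]}     []                  f≤g = f≤g [] refl
  Ex-mono {p ∷ ps} ((0≤p , p≤1) ∷ pps) f≤g = ℚ.+-mono-≤
    (*-monoˡ-≤-0≤ 0≤p       (Ex-mono pps (λ bs eq → f≤g (true ∷ bs) (cong suc eq))))
    (*-monoˡ-≤-0≤ (0≤1-p p≤1) (Ex-mono pps (λ bs eq → f≤g (false ∷ bs) (cong suc eq))))

  Ex-0≤ : ∀ {ps f} → Probabilities ps → (∀ bs → 0ℚ ≤ f bs) → 0ℚ ≤ Ex ps f
  Ex-0≤ {[]}     []                  0≤f = 0≤f []
  Ex-0≤ {p ∷ ps} ((0≤p , p≤1) ∷ pps) 0≤f = ℚ.+-mono-≤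
    (*-0≤ 0≤p       (Ex-0≤ pps (0≤f ∘ (true ∷_))))
    (*-0≤ (0≤1-p p≤1) (Ex-0≤ pps (0≤f ∘ (false ∷_))))

  indicator-0≤ : ∀ b → 0ℚ ≤ indicator b
  indicator-0≤ true  = 0≤1
  indicator-0≤ false = ℚ.≤-refl

  Pr-0≤ : ∀ {ps} f → Probabilities ps → 0ℚ ≤ Pr ps f
  Pr-0≤ {ps} f pps rewrite Pr≡Ex-indicator ps f = Ex-0≤ pps (indicator-0≤ ∘ f)

  ½^-probabilities : ∀ es → Probabilities (map (powℚ ½) es)
  ½^-probabilities es = All.map⁺ (tabulate (λ {e} _ → powℚ-0≤ e 0≤½ , powℚ-≤1 e 0≤½ ½≤1))

  markov : ∀ {ps λ′} (X : List Bool → ℕ) B → Probabilities ps → 1ℚ ≤ λ′ →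
           Pr ps (λ bs → B ℕ.<ᵇ X bs) * powℚ λ′ (suc B) ≤ Ex ps (λ bs → powℚ λ′ (X bs))
  markov {ps} {λ′} X B pps 1≤λ′ = begin
    Pr ps tail * c                          ≡⟨ ℚ.*-comm _ c ⟩
    c * Pr ps tail                          ≡⟨ cong (c *_) (Pr≡Ex-indicator ps tail) ⟩
    c * Ex ps (indicator ∘ tail)            ≡⟨ Ex-*ˡ ps c (indicator ∘ tail) ⟨
    Ex ps (λ bs → c * indicator (tail bs))  ≤⟨ Ex-mono pps (λ bs _ → pointwise bs) ⟩
    Ex ps (λ bs → powℚ λ′ (X bs))           ∎
    where
    open ℚ.≤-Reasoning
    tail : List Bool → Bool
    tail bs = B ℕ.<ᵇ X bs
    c = powℚ λ′ (suc B)
    pointwise : ∀ bs → c * indicator (tail bs) ≤ powℚ λ′ (X bs)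
    pointwise bs with B ℕ.<ᵇ X bs in eq
    ... | true  = ℚ.≤-trans (ℚ.≤-reflexive (ℚ.*-identityʳ c))
                    (powℚ-monoʳ-≤ 1≤λ′ (ℕ.<ᵇ⇒< B (X bs) (Equivalence.from T-≡ eq)))
    ... | false = ℚ.≤-trans (ℚ.≤-reflexive (ℚ.*-zeroʳ c)) (powℚ-0≤ (X bs) (ℚ.≤-trans 0≤1 1≤λ′))

module Labelling {n : ℕ} where
  open import Data.Nat using (_≡ᵇ_; _≤_; _<_)
  open import Data.Nat.ListAction using (sum)
  open import Data.List.Membership.Propositional.Properties using (∈-allFin)
  import Data.Fin.Properties as Fin
  open Preliminaries

  -- Under this invariant the components of a labelling are counted by its roots, the
  -- vertices w labelled toℕ w.
  Canonical : (Fin n → ℕ) → Set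
  Canonical f = ∀ w → Σ (Fin n) λ r → toℕ r ≡ f w × f r ≡ f w

  CanonicalState : State n → Set
  CanonicalState S = ∀ i → Canonical (S i)

  initState-canonical : CanonicalState initState
  initState-canonical i w = w , refl , refl

  Canonical-cong : ∀ {f g : Fin n → ℕ} → (∀ w → g w ≡ f w) → Canonical f → Canonical g
  Canonical-cong g≗f can w with can w
  ... | r , r≡fw , fr≡fw = r , trans r≡fw (sym (g≗f w)) , trans (g≗f r) (trans fr≡fw (sym (g≗f w)))

  isRoot : (Fin n → ℕ) → Fin n → ℕ
  isRoot f w = if f w ≡ᵇ toℕ w then 1 else 0

  #roots : (Fin n → ℕ) → ℕ
  #roots f = sum (map (isRoot f) (allFin n))

  merge : (Fin n → ℕ) → Fin n → Fin n → Fin n → ℕ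
  merge f u v w = if f w ≡ᵇ f v then f u else f w

  #roots-cong : ∀ {f g} → (∀ w → f w ≡ g w) → #roots f ≡ #roots g
  #roots-cong f≗g = cong sum (List.map-cong (λ w → cong (λ a → if a ≡ᵇ toℕ w then 1 else 0) (f≗g w)) (allFin n))

  #roots-toℕ : #roots toℕ ≡ n
  #roots-toℕ = begin
    sum (map (isRoot toℕ) (allFin n))
      ≡⟨ cong sum (List.map-cong (λ w → cong (λ b → if b then 1 else 0) (≡ᵇ-refl (toℕ w))) (allFin n)) ⟩
    sum (map (λ _ → 1) (allFin n))
      ≡⟨ sum-map-1 (allFin n) ⟩
    length (allFin n)
      ≡⟨ List.length-tabulate id ⟩
    n ∎
    where
    open ≡-Reasoning
    sum-map-1 : ∀ {A : Set} (xs : List A) → sum (map (λ _ → 1) xs) ≡ length xs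
    sum-map-1 []       = refl
    sum-map-1 (x ∷ xs) = cong suc (sum-map-1 xs)

  merge-of-connected : ∀ f u v → f u ≡ f v → ∀ w → merge f u v w ≡ f w
  merge-of-connected f u v fu≡fv w with f w ≡ᵇ f v in eq
  ... | true  = trans fu≡fv (sym (≡ᵇ-true⇒≡ eq))
  ... | false = refl

  merge-of-label-u : ∀ f u v w → f w ≡ f u → merge f u v w ≡ f u
  merge-of-label-u f u v w fw≡fu with f w ≡ᵇ f v
  ... | true  = refl
  ... | false = fw≡fu

  merge-of-label-≢v : ∀ f u v w → f w ≢ f v → merge f u v w ≡ f w
  merge-of-label-≢v f u v w fw≢fv rewrite ≢⇒≡ᵇ-false fw≢fv = refl

  merge-of-label-v : ∀ f u v w → f w ≡ f v → merge f u v w ≡ f u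
  merge-of-label-v f u v w fw≡fv rewrite fw≡fv | ≡ᵇ-refl (f v) = refl

  merge-canonical : ∀ f u v → Canonical f → Canonical (merge f u v)
  merge-canonical f u v can w with f w ≡ᵇ f v in eq
  ... | true  with can u
  ...   | r , r≡fu , fr≡fu = r , r≡fu , merge-of-label-u f u v r fr≡fu
  merge-canonical f u v can w | false with can w
  ...   | r , r≡fw , fr≡fw =
    r , r≡fw , trans (merge-of-label-≢v f u v r (λ fr≡fv → ≡ᵇ-false⇒≢ eq (trans (sym fr≡fw) fr≡fv))) fr≡fw

  isRoot-≡ : ∀ {f w} → f w ≡ toℕ w → isRoot f w ≡ 1
  isRoot-≡ {f} {w} eq rewrite eq | ≡ᵇ-refl (toℕ w) = refl

  isRoot-≢ : ∀ {f w} → f w ≢ toℕ w → isRoot f w ≡ 0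
  isRoot-≢ neq rewrite ≢⇒≡ᵇ-false neq = refl

  merge-#roots-< : ∀ f u v → Canonical f → f u ≢ f v → #roots (merge f u v) < #roots f
  merge-#roots-< f u v can fu≢fv with can v
  ... | rᵥ , rᵥ≡fv , frᵥ≡fv = sum-map-mono-< pointwise (∈-allFin rᵥ) strict
    where
    strict : isRoot (merge f u v) rᵥ < isRoot f rᵥ
    strict = subst₂ _<_
      (sym (isRoot-≢ {merge f u v} (λ eq → fu≢fv (trans (sym (merge-of-label-v f u v rᵥ frᵥ≡fv)) (trans eq rᵥ≡fv)))))
      (sym (isRoot-≡ {f} (trans frᵥ≡fv (sym rᵥ≡fv))))
      (s≤s z≤n)
    pointwise : ∀ w → isRoot (merge f u v) w ≤ isRoot f w
    pointwise w with f w ≡ᵇ f v in fw≡fv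
    ... | false = ℕ.≤-refl
    ... | true  with f u ≡ᵇ toℕ w in fu≡w
    ...   | false = z≤n
    ...   | true  with can u
    ...     | r , r≡fu , fr≡fu = ⊥-elim (fu≢fv (begin
      f u ≡⟨ fr≡fu ⟨
      f r ≡⟨ cong f (Fin.toℕ-injective (trans r≡fu (≡ᵇ-true⇒≡ fu≡w))) ⟩
      f w ≡⟨ ≡ᵇ-true⇒≡ fw≡fv ⟩
      f v ∎))
      where open ≡-Reasoning

module Execution {n : ℕ} (u v : Fin n) where
  open import Data.Nat using (_≡ᵇ_)
  open Preliminaries
  open Labelling {n}

  step : State n → ℕ → Bool → State n
  step S j b = if b ∧ connected S (j ∸ 1) u v then addEdge S j u v else S

  addEdge-≡ : ∀ S j w → addEdge S j u v j w ≡ merge (S j) u v w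
  addEdge-≡ S j w rewrite ≡ᵇ-refl j = refl

  addEdge-≢ : ∀ S {i j} w → i ≢ j → addEdge S j u v i w ≡ S i w
  addEdge-≢ S w i≢j rewrite ≢⇒≡ᵇ-false i≢j = refl

  step-≢ : ∀ S {i j} b w → i ≢ j → step S j b i w ≡ S i w
  step-≢ S {j = j} b w i≢j with b ∧ connected S (j ∸ 1) u v
  ... | true  = addEdge-≢ S w i≢j
  ... | false = refl

  addEdge-canonical : ∀ S j → CanonicalState S → CanonicalState (addEdge S j u v)
  addEdge-canonical S j can i with i ℕ.≟ j
  ... | yes refl = Canonical-cong (addEdge-≡ S j) (merge-canonical (S j) u v (can j))
  ... | no  i≢j  = Canonical-cong (λ w → addEdge-≢ S w i≢j) (can i)

  step-canonical : ∀ S j b → CanonicalState S → CanonicalState (step S j b)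
  step-canonical S j b can with b ∧ connected S (j ∸ 1) u v
  ... | true  = addEdge-canonical S j can
  ... | false = can

  processEdge-canonical : ∀ S j bs → CanonicalState S → CanonicalState (processEdge S u v j bs)
  processEdge-canonical S j []       can = can
  processEdge-canonical S j (b ∷ bs) can = processEdge-canonical (step S j b) (suc j) bs (step-canonical S j b can)

  connected-cong : ∀ {S S′} i → (∀ w → S′ i w ≡ S i w) → connected S′ i u v ≡ connected S i u v
  connected-cong zero    _   = refl
  connected-cong (suc i) S≗S′ = cong₂ _≡ᵇ_ (S≗S′ u) (S≗S′ v)

  step-connected : ∀ S j b → connected S (suc j) u v ≡ true → connected (step S (suc j) b) (suc j) u v ≡ true
  step-connected S j b uv with b ∧ connected S j u v
  ... | false = uv
  ... | true  rewrite addEdge-≡ S (suc j) u | addEdge-≡ S (suc j) v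
                    | merge-of-label-u (S (suc j)) u v u refl | merge-of-label-v (S (suc j)) u v v refl
                    = ≡ᵇ-refl (S (suc j) u)

  step-of-disconnected : ∀ S j b → connected S j u v ≡ false → step S (suc j) b ≡ S
  step-of-disconnected S j true  uv rewrite uv = refl
  step-of-disconnected S j false uv = refl

  step-of-trial : ∀ S j → connected S j u v ≡ true → step S (suc j) true ≡ addEdge S (suc j) u v
  step-of-trial S j uv rewrite uv = refl

  step-of-connected : ∀ S j b → connected S (suc j) u v ≡ true → ∀ i w → step S (suc j) b i w ≡ S i w
  step-of-connected S j b uv i w with b ∧ connected S j u v
  ... | false = refl
  ... | true  with i ℕ.≟ suc j
  ...   | yes refl = trans (addEdge-≡ S (suc j) w) (merge-of-connected (S (suc j)) u v (≡ᵇ-true⇒≡ uv) w)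
  ...   | no  i≢j  = addEdge-≢ S w i≢j

  addEdge-#roots-< : ∀ S j → CanonicalState S → connected S (suc j) u v ≡ false →
                     #roots (addEdge S (suc j) u v (suc j)) ℕ.< #roots (S (suc j))
  addEdge-#roots-< S j can uv = subst (ℕ._< #roots (S (suc j))) (#roots-cong (λ w → sym (addEdge-≡ S (suc j) w)))
    (merge-#roots-< (S (suc j)) u v (can (suc j)) (≡ᵇ-false⇒≢ uv))

  1<J-of-disconnected : ∀ S J → connected S (J ∸ 1) u v ≡ false → 1 ℕ.< J
  1<J-of-disconnected S (suc (suc J)) _ = s≤s (s≤s z≤n)

module Potential {n : ℕ} where
  open import Data.Rational using (ℚ; 0ℚ; 1ℚ; _*_; _≤_)
  open Arithmetic
  open Labelling {n}
  open +-*-Solver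

  potential : ℕ → List ℚ → State n → ℚ
  potential i []       S = 1ℚ
  potential i (w ∷ ws) S = powℚ w (#roots (S i)) * potential (suc i) ws S

  potential-1≤ : ∀ i {ws} S → All (1ℚ ≤_) ws → 1ℚ ≤ potential i ws S
  potential-1≤ i S []          = ℚ.≤-refl
  potential-1≤ i S (1≤w ∷ 1≤ws) =
    *-mono-≤-0≤ (ℚ.≤-trans 0≤1 (powℚ-1≤ r 1≤w)) 0≤1 (powℚ-1≤ r 1≤w) (potential-1≤ (suc i) S 1≤ws)
    where r = #roots (S i)

  potential-0≤ : ∀ i {ws} S → All (1ℚ ≤_) ws → 0ℚ ≤ potential i ws S
  potential-0≤ i S 1≤ws = ℚ.≤-trans 0≤1 (potential-1≤ i S 1≤ws)

  potential-cong : ∀ i ws {S S′} → (∀ i′ → #roots (S′ i′) ≡ #roots (S i′)) → potential i ws S′ ≡ potential i ws S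
  potential-cong i []       S≗S′ = refl
  potential-cong i (w ∷ ws) S≗S′ = cong₂ _*_ (cong (powℚ w) (S≗S′ i)) (potential-cong (suc i) ws S≗S′)

  potential-unchanged-outside : ∀ i ws {j S S′} → (∀ i′ → i′ ≢ j → #roots (S′ i′) ≡ #roots (S i′)) →
    j ℕ.< i ⊎ i ℕ.+ length ws ℕ.≤ j → potential i ws S′ ≡ potential i ws S
  potential-unchanged-outside i []       S≗S′ j∉ = refl
  potential-unchanged-outside i (w ∷ ws) S≗S′ (inj₁ j<i) =
    cong₂ _*_ (cong (powℚ w) (S≗S′ i (λ i≡j → ℕ.<-irrefl (sym i≡j) j<i)))
              (potential-unchanged-outside (suc i) ws S≗S′ (inj₁ (ℕ.m<n⇒m<1+n j<i)))
  potential-unchanged-outside i (w ∷ ws) S≗S′ (inj₂ i+≤j) =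
    cong₂ _*_ (cong (powℚ w) (S≗S′ i (λ { refl → ℕ.m+1+n≰m i i+≤j })))
              (potential-unchanged-outside (suc i) ws S≗S′ (inj₂ (ℕ.≤-trans (ℕ.≤-reflexive (sym (ℕ.+-suc i (length ws)))) i+≤j)))

  potential-drop : ∀ pre {w} post i {j S S′} → j ≡ length pre ℕ.+ i → All (1ℚ ≤_) (pre ++ w ∷ post) →
    (∀ i′ → i′ ≢ j → #roots (S′ i′) ≡ #roots (S i′)) → #roots (S′ j) ℕ.< #roots (S j) →
    potential i (pre ++ w ∷ post) S′ * w ≤ potential i (pre ++ w ∷ post) S
  potential-drop [] {w} post i {S = S} {S′} refl (1≤w ∷ 1≤post) S≗S′ drop = begin
    powℚ w (#roots (S′ i)) * potential (suc i) post S′ * w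
      ≡⟨ cong (λ z → powℚ w (#roots (S′ i)) * z * w)
              (potential-unchanged-outside (suc i) post S≗S′ (inj₁ (ℕ.n<1+n i))) ⟩
    powℚ w (#roots (S′ i)) * P * w
      ≡⟨ solve 3 (λ a P w → a :* P :* w := (w :* a) :* P) refl (powℚ w (#roots (S′ i))) P w ⟩
    powℚ w (suc (#roots (S′ i))) * P
      ≤⟨ *-monoʳ-≤-0≤ (potential-0≤ (suc i) S 1≤post) (powℚ-monoʳ-≤ 1≤w drop) ⟩
    powℚ w (#roots (S i)) * P ∎
    where
    open ℚ.≤-Reasoning
    P = potential (suc i) post S
  potential-drop (x ∷ pre) {w} post i {j} {S} {S′} j≡ (1≤x ∷ 1≤ws) S≗S′ drop = begin
    powℚ x (#roots (S′ i)) * P′ * w   ≡⟨ cong (λ r → powℚ x r * P′ * w) (S≗S′ i i≢j) ⟩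
    powℚ x (#roots (S i)) * P′ * w    ≡⟨ ℚ.*-assoc (powℚ x (#roots (S i))) P′ w ⟩
    powℚ x (#roots (S i)) * (P′ * w)  ≤⟨ *-monoˡ-≤-0≤ (powℚ-0≤ (#roots (S i)) (ℚ.≤-trans 0≤1 1≤x))
                                          (potential-drop pre post (suc i) (trans j≡ (sym (ℕ.+-suc _ i))) 1≤ws S≗S′ drop) ⟩
    powℚ x (#roots (S i)) * P         ∎
    where
    open ℚ.≤-Reasoning
    P′ = potential (suc i) (pre ++ w ∷ post) S′
    P = potential (suc i) (pre ++ w ∷ post) S
    i≢j : i ≢ j
    i≢j i≡j = ℕ.<-irrefl (trans i≡j j≡) (s≤s (ℕ.m≤n+m i (length pre)))

  potential-initState : ∀ i ws → potential i ws initState ≡ powℚ (prodℚ ws) n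
  potential-initState i []       = sym (powℚ-1ℚ n)
  potential-initState i (w ∷ ws) = begin
    powℚ w (#roots toℕ) * potential (suc i) ws initState
      ≡⟨ cong₂ _*_ (cong (powℚ w) #roots-toℕ) (potential-initState (suc i) ws) ⟩
    powℚ w n * powℚ (prodℚ ws) n
      ≡⟨ powℚ-distrib-* w (prodℚ ws) n ⟨
    powℚ (w * prodℚ ws) n ∎
    where open ≡-Reasoning

module LevelWeights (l : ℕ) where
  open import Data.Rational using (ℚ; 0ℚ; 1ℚ; ½; _+_; _*_; _≤_)
  open Arithmetic

  h : ℚ
  h = powℚ ½ l

  0≤h : 0ℚ ≤ h
  0≤h = powℚ-0≤ l 0≤½

  weight : ℕ → ℚ
  weight e = 1ℚ + powℚ two e * h

  growth : ℚ
  growth = 1ℚ + h * ½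

  1≤weight : ∀ e → 1ℚ ≤ weight e
  1≤weight e = 1≤1+x (*-0≤ (powℚ-0≤ e 0≤two) 0≤h)

  1≤growth : 1ℚ ≤ growth
  1≤growth = 1≤1+x (*-0≤ 0≤h 0≤½)

  1≤weights : ∀ es → All (1ℚ ≤_) (map weight es)
  1≤weights es = All.map⁺ (tabulate (λ {e} _ → 1≤weight e))

module Supermartingale {n : ℕ} (l J : ℕ) (levels : List ℕ) where
  open import Data.Rational using (ℚ; 0ℚ; 1ℚ; ½; _+_; _*_; _-_; _≤_)
  open Preliminaries
  open Arithmetic
  open Expectation
  open Labelling {n}
  open Potential {n}
  open LevelWeights l
  open +-*-Solver

  -- Index i ≥ 1 has level levels[i-1]; Φ weighs the structures D_1 … D_{J-1}.
  weights : List ℚ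
  weights = map weight (take (J ∸ 1) levels)

  Φ : State n → ℚ
  Φ = potential 1 weights

  0≤Φ : ∀ S → 0ℚ ≤ Φ S
  0≤Φ S = potential-0≤ 1 S (1≤weights (take (J ∸ 1) levels))

  nontrial-cases : ∀ a b c → a ∧ (b ∧ not c) ≡ false → a ≡ false ⊎ b ≡ false ⊎ c ≡ true
  nontrial-cases false b     c     _ = inj₁ refl
  nontrial-cases true  false c     _ = inj₂ (inj₁ refl)
  nontrial-cases true  true  true  _ = inj₂ (inj₂ refl)

  trial-cases : ∀ a b c → a ∧ (b ∧ not c) ≡ true → a ≡ true × b ≡ true × c ≡ false
  trial-cases true true false _ = refl , refl , refl

  take-levels-split : ∀ {pre} e es → levels ≡ pre ++ e ∷ es → suc (length pre) ℕ.< J →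
                      take (J ∸ 1) levels ≡ pre ++ e ∷ take (J ∸ 1 ∸ suc (length pre)) es
  take-levels-split {pre} e es levels≡ i<J =
    trans (cong (take (J ∸ 1)) levels≡) (take-++-∷ pre e es (J ∸ 1) (suc<⇒<∸1 i<J))

  trial-level-≤ : ∀ {pre} e es → levels ≡ pre ++ e ∷ es → suc (length pre) ℕ.< J →
                  All (ℕ._≤ l) (take (J ∸ 1) levels) → e ℕ.≤ l
  trial-level-≤ {pre} e es levels≡ i<J bounded
    with All.++⁻ʳ pre (subst (All (ℕ._≤ l)) (take-levels-split e es levels≡ i<J) bounded)
  ... | e≤l ∷ _ = e≤l

  module _ (u v : Fin n) where
    open Execution u v

    trial : State n → ℕ → Bool
    trial S j = (j ℕ.<ᵇ J) ∧ (connected S (j ∸ 1) u v ∧ not (connected S j u v))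

    #trials : State n → ℕ → List Bool → ℕ
    #trials S j []       = 0
    #trials S j (b ∷ bs) = (if trial S j then 1 else 0) ℕ.+ #trials (step S j b) (suc j) bs

    nontrial-step : ∀ S i b → trial S (suc i) ≡ false → Φ (step S (suc i) b) ≡ Φ S
    nontrial-step S i b ¬trial with nontrial-cases (suc i ℕ.<ᵇ J) (connected S i u v) (connected S (suc i) u v) ¬trial
    ... | inj₁ i≮J = potential-unchanged-outside 1 weights {S = S} {step S (suc i) b}
                       (λ i′ i′≢ → #roots-cong (λ w → step-≢ S b w i′≢)) (inj₂ beyond)
      where
      J≤1+i : J ℕ.≤ suc i
      J≤1+i = ℕ.≮⇒≥ (λ lt → subst T i≮J (ℕ.<⇒<ᵇ lt))
      beyond : suc (length weights) ℕ.≤ suc i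
      beyond = s≤s (begin
        length (map weight (take (J ∸ 1) levels)) ≡⟨ List.length-map weight (take (J ∸ 1) levels) ⟩
        length (take (J ∸ 1) levels)              ≤⟨ length-take-≤ (J ∸ 1) levels ⟩
        J ∸ 1                                     ≤⟨ ℕ.∸-monoˡ-≤ {J} {suc i} 1 J≤1+i ⟩
        i                                         ∎)
        where open ℕ.≤-Reasoning
    ... | inj₂ (inj₁ disconnected) = cong Φ (step-of-disconnected S i b disconnected)
    ... | inj₂ (inj₂ connected′)   =
      potential-cong 1 weights {S} {step S (suc i) b} (λ i′ → #roots-cong (step-of-connected S i b connected′ i′))

    trial-divides-Φ : ∀ S {pre} e es → levels ≡ pre ++ e ∷ es → suc (length pre) ℕ.< J → CanonicalState S →
      connected S (suc (length pre)) u v ≡ false → Φ (addEdge S (suc (length pre)) u v) * weight e ≤ Φ S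
    trial-divides-Φ S {pre} e es levels≡ i<J can disconnected =
      subst (λ ws → potential 1 ws S′ * weight e ≤ potential 1 ws S) (sym weights≡)
        (potential-drop (map weight pre) (map weight post) 1
          (trans (ℕ.+-comm 1 (length pre)) (cong (ℕ._+ 1) (sym (List.length-map weight pre))))
          (subst (All (1ℚ ≤_)) weights≡ (1≤weights (take (J ∸ 1) levels)))
          (λ i′ i′≢ → #roots-cong (λ w → addEdge-≢ S w i′≢))
          (addEdge-#roots-< S (length pre) can disconnected))
      where
      S′ = addEdge S (suc (length pre)) u v
      post = take (J ∸ 1 ∸ suc (length pre)) es
      weights≡ : weights ≡ map weight pre ++ weight e ∷ map weight post
      weights≡ = trans (cong (map weight) (take-levels-split e es levels≡ i<J)) (List.map-++ weight pre (e ∷ post))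

    trial-step : ∀ S {pre} e es → levels ≡ pre ++ e ∷ es → CanonicalState S → All (ℕ._≤ l) (take (J ∸ 1) levels) →
      let j = suc (length pre)
          c = powℚ growth (if trial S j then 1 else 0) in
      powℚ ½ e * (c * Φ (step S j true)) + (1ℚ - powℚ ½ e) * (c * Φ (step S j false)) ≤ Φ S
    trial-step S {pre} e es levels≡ can bounded with trial S (suc (length pre)) in isTrial
    ... | false rewrite nontrial-step S (length pre) true isTrial = ℚ.≤-reflexive
      (solve 2 (λ p P → p :* (con 1ℚ :* P) :+ (con 1ℚ :- p) :* (con 1ℚ :* P) := P) refl (powℚ ½ e) (Φ S))
    ... | true with trial-cases (suc (length pre) ℕ.<ᵇ J) (connected S (length pre) u v) (connected S (suc (length pre)) u v) isTrial
    ...   | i<ᵇJ , connected-prev , disconnected = begin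
      p * ((growth * 1ℚ) * Φ (step S (suc (length pre)) true)) + (1ℚ - p) * ((growth * 1ℚ) * Φ S)
        ≡⟨ cong₂ (λ g P → p * (g * P) + (1ℚ - p) * (g * Φ S))
                 (ℚ.*-identityʳ growth) (cong Φ (step-of-trial S (length pre) connected-prev)) ⟩
      p * (growth * Φ (addEdge S (suc (length pre)) u v)) + (1ℚ - p) * (growth * Φ S)
        ≤⟨ trial-supermartingale (powℚ-0≤ e 0≤½) (powℚ-0≤ e 0≤two) (½^e*2^e≡1 e) 0≤h
             (2^e*½^l≤1 (trial-level-≤ e es levels≡ i<J bounded))
             (0≤Φ S) (trial-divides-Φ S e es levels≡ i<J can disconnected) ⟩
      Φ S ∎
      where
      open ℚ.≤-Reasoning
      p = powℚ ½ e
      i<J : suc (length pre) ℕ.< J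
      i<J = ℕ.<ᵇ⇒< _ J (Equivalence.from T-≡ i<ᵇJ)

    Ψ : State n → ℕ → List Bool → ℚ
    Ψ S j bs = powℚ growth (#trials S j bs) * Φ (processEdge S u v j bs)

    edge-supermartingale : ∀ {pre} es S → levels ≡ pre ++ es → CanonicalState S → All (ℕ._≤ l) (take (J ∸ 1) levels) →
      Ex (map (powℚ ½) es) (Ψ S (suc (length pre))) ≤ Φ S
    edge-supermartingale       []       S _       _   _       = ℚ.≤-reflexive (ℚ.*-identityˡ (Φ S))
    edge-supermartingale {pre} (e ∷ es) S levels≡ can bounded = begin
      p * Ex ps (Ψ S j ∘ (true ∷_)) + (1ℚ - p) * Ex ps (Ψ S j ∘ (false ∷_))
        ≡⟨ cong₂ (λ a b → p * a + (1ℚ - p) * b) (factor true) (factor false) ⟩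
      p * (c * Ex ps (Ψ (step S j true) (suc j))) + (1ℚ - p) * (c * Ex ps (Ψ (step S j false) (suc j)))
        ≤⟨ ℚ.+-mono-≤ (*-monoˡ-≤-0≤ (powℚ-0≤ e 0≤½) (*-monoˡ-≤-0≤ 0≤c (ih true)))
                      (*-monoˡ-≤-0≤ (0≤1-p (powℚ-≤1 e 0≤½ ½≤1)) (*-monoˡ-≤-0≤ 0≤c (ih false))) ⟩
      p * (c * Φ (step S j true)) + (1ℚ - p) * (c * Φ (step S j false))
        ≤⟨ trial-step S e es levels≡ can bounded ⟩
      Φ S ∎
      where
      open ℚ.≤-Reasoning
      j = suc (length pre)
      p = powℚ ½ e
      ps = map (powℚ ½) es
      c = powℚ growth (if trial S j then 1 else 0)
      0≤c : 0ℚ ≤ c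
      0≤c = powℚ-0≤ (if trial S j then 1 else 0) (ℚ.≤-trans 0≤1 1≤growth)
      factor : ∀ b → Ex ps (Ψ S j ∘ (b ∷_)) ≡ c * Ex ps (Ψ (step S j b) (suc j))
      factor b = trans (Ex-cong ps (λ bs → trans (cong (_* Φ (processEdge (step S j b) u v (suc j) bs))
                                                        (powℚ-+ growth (if trial S j then 1 else 0) _))
                                                 (ℚ.*-assoc c _ _)))
                       (Ex-*ˡ ps c (Ψ (step S j b) (suc j)))
      ih : ∀ b → Ex ps (Ψ (step S j b) (suc j)) ≤ Φ (step S j b)
      ih b = subst (λ k → Ex ps (Ψ (step S j b) (suc k)) ≤ Φ (step S j b))
               (trans (List.length-++ pre) (ℕ.+-comm (length pre) 1))
               (edge-supermartingale {pre ++ [ e ]} es (step S j b) (trans levels≡ (sym (List.++-assoc pre [ e ] es)))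
                  (step-canonical S j b can) bounded)

    trial-before-J : ∀ S i bs → suc i ℕ.< J → connected S i u v ≡ true → connected S (J ∸ 1) u v ≡ false →
                     J ∸ suc i ℕ.≤ length bs → 1 ℕ.≤ #trials S (suc i) bs
    trial-before-J S i []       i<J _ _ J≤ = ⊥-elim (ℕ.n≮0 (ℕ.<-≤-trans (ℕ.m<n⇒0<n∸m i<J) J≤))
    trial-before-J S i (b ∷ bs) i<J uv-prev ¬uv-J J≤ with connected S (suc i) u v in uv
    ... | false rewrite Equivalence.to T-≡ (ℕ.<⇒<ᵇ i<J) | uv-prev = s≤s z≤n
    ... | true  = ℕ.≤-trans (trial-before-J (step S (suc i) b) (suc i) bs i+1<J
                                (step-connected S i b uv) ¬uv-J′ J≤′)
                            (ℕ.m≤n+m _ _)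
      where
      J-1≢ : J ∸ 1 ≢ suc i
      J-1≢ eq with trans (sym ¬uv-J) (trans (cong (λ j → connected S j u v) eq) uv)
      ... | ()
      i+1<J : suc (suc i) ℕ.< J
      i+1<J = <∸1⇒suc< (ℕ.≤∧≢⇒< (suc<⇒<∸1 i<J) (J-1≢ ∘ sym))
      ¬uv-J′ : connected (step S (suc i) b) (J ∸ 1) u v ≡ false
      ¬uv-J′ = trans (connected-cong (J ∸ 1) (λ w → step-≢ S b w J-1≢)) ¬uv-J
      J≤′ : J ∸ suc (suc i) ℕ.≤ length bs
      J≤′ = subst (ℕ._≤ length bs) (ℕ.pred[m∸n]≡m∸[1+n] J (suc i)) (ℕ.pred-mono-≤ J≤)

    disconnected⇒trial : ∀ S bs → connected S (J ∸ 1) u v ≡ false → J ∸ 1 ℕ.≤ length bs → 1 ℕ.≤ #trials S 1 bs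
    disconnected⇒trial S bs ¬uv = trial-before-J S 0 bs (1<J-of-disconnected S J ¬uv) refl ¬uv

  stream-supermartingale : ∀ L K → bitProbsEdge L K ≡ map (powℚ ½) levels → length levels ≡ L ℕ.* K →
    J ∸ 1 ℕ.≤ L ℕ.* K → All (ℕ._≤ l) (take (J ∸ 1) levels) →
    ∀ es S → CanonicalState S →
    Ex (bitProbs L K (length es)) (λ bs → powℚ growth (countNotX (L ℕ.* K) J S es bs)) ≤ Φ S
  stream-supermartingale L K probs≡ length≡ J≤ bounded [] S can = potential-1≤ 1 S (1≤weights (take (J ∸ 1) levels))
  stream-supermartingale L K probs≡ length≡ J≤ bounded ((u , v) ∷ es) S can = begin
    Ex (pe ++ rest) F
      ≡⟨ Ex-++ pe rest F ⟩
    Ex pe (λ as → Ex rest (λ bs → F (as ++ bs)))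
      ≤⟨ Ex-mono (subst Probabilities (sym probs≡) (½^-probabilities levels)) per-edge ⟩
    Ex pe (Ψ u v S 1)
      ≡⟨ cong (λ ps → Ex ps (Ψ u v S 1)) probs≡ ⟩
    Ex (map (powℚ ½) levels) (Ψ u v S 1)
      ≤⟨ edge-supermartingale u v {[]} levels S refl can bounded ⟩
    Φ S ∎
    where
    open ℚ.≤-Reasoning
    LK = L ℕ.* K
    pe = bitProbsEdge L K
    rest = bitProbs L K (length es)
    F : List Bool → ℚ
    F bs = powℚ growth (countNotX LK J S ((u , v) ∷ es) bs)
    notX : ℕ
    notX = if connected S (J ∸ 1) u v then 0 else 1
    notX≤#trials : ∀ as → length as ≡ LK → notX ℕ.≤ #trials u v S 1 as
    notX≤#trials as len with connected S (J ∸ 1) u v in uv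
    ... | true  = z≤n
    ... | false = disconnected⇒trial u v S as uv (subst (J ∸ 1 ℕ.≤_) (sym len) J≤)
    per-edge : ∀ as → length as ≡ length pe → Ex rest (λ bs → F (as ++ bs)) ≤ Ψ u v S 1 as
    per-edge as len = begin
      Ex rest (λ bs → F (as ++ bs))
        ≡⟨ Ex-cong rest (λ bs → trans (cong₂ (λ xs ys → powℚ growth (notX ℕ.+ countNotX LK J (processEdge S u v 1 xs) es ys))
                                              (take-length-++ as bs len′) (drop-length-++ as bs len′))
                                       (powℚ-+ growth notX _)) ⟩
      Ex rest (λ bs → powℚ growth notX * powℚ growth (countNotX LK J Sₐ es bs))
        ≡⟨ Ex-*ˡ rest (powℚ growth notX) _ ⟩
      powℚ growth notX * Ex rest (λ bs → powℚ growth (countNotX LK J Sₐ es bs))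
        ≤⟨ *-monoˡ-≤-0≤ (powℚ-0≤ notX (ℚ.≤-trans 0≤1 1≤growth))
             (stream-supermartingale L K probs≡ length≡ J≤ bounded es Sₐ (Execution.processEdge-canonical u v S 1 as can)) ⟩
      powℚ growth notX * Φ Sₐ
        ≤⟨ *-monoʳ-≤-0≤ (0≤Φ Sₐ) (powℚ-monoʳ-≤ 1≤growth (notX≤#trials as len′)) ⟩
      Ψ u v S 1 as ∎
      where
      Sₐ = processEdge S u v 1 as
      len′ : length as ≡ LK
      len′ = trans len (subst (λ ps → length ps ≡ LK) (sym probs≡) (trans (List.length-map (powℚ ½) levels) length≡))

module Levels where
  open import Data.Nat using (_≤_; _*_)
  open Preliminaries

  -- The levels of the LK bits of one edge: bit J = K(l-1)+k has level l.
  blocks : ℕ → List ℕ → List ℕ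
  blocks K = concatMap (λ i → replicate K (suc i))

  levels : ℕ → ℕ → List ℕ
  levels L K = blocks K (upTo L)

  bitProbsEdge≡ : ∀ L K → bitProbsEdge L K ≡ map (powℚ ℚ.½) (levels L K)
  bitProbsEdge≡ L K = sym (trans (List.map-concatMap (powℚ ℚ.½) _ (upTo L))
                                 (List.concatMap-cong (λ i → List.map-replicate (powℚ ℚ.½) K (suc i)) (upTo L)))

  length-blocks : ∀ K xs → length (blocks K xs) ≡ length xs * K
  length-blocks K []       = refl
  length-blocks K (x ∷ xs) = trans (List.length-++ (replicate K (suc x)))
                                   (cong₂ ℕ._+_ (List.length-replicate K) (length-blocks K xs))

  length-levels : ∀ L K → length (levels L K) ≡ L * K
  length-levels L K = trans (length-blocks K (upTo L)) (cong (_* K) (List.length-upTo L))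

  take-blocks : ∀ K m xs → take (K * m) (blocks K xs) ≡ blocks K (take m xs)
  take-blocks K zero    xs rewrite ℕ.*-zeroʳ K = refl
  take-blocks K (suc m) []       = List.take-[] (K * suc m)
  take-blocks K (suc m) (x ∷ xs) rewrite ℕ.*-suc K m = begin
    take (K ℕ.+ K * m) (replicate K (suc x) ++ blocks K xs)
      ≡⟨ cong (λ k → take (k ℕ.+ K * m) (replicate K (suc x) ++ blocks K xs)) (List.length-replicate K) ⟨
    take (length (replicate K (suc x)) ℕ.+ K * m) (replicate K (suc x) ++ blocks K xs)
      ≡⟨ take-length-+ (replicate K (suc x)) (K * m) (blocks K xs) ⟩
    replicate K (suc x) ++ take (K * m) (blocks K xs)
      ≡⟨ cong (replicate K (suc x) ++_) (take-blocks K m xs) ⟩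
    replicate K (suc x) ++ blocks K (take m xs) ∎
    where open ≡-Reasoning

  levels-≤ : ∀ l K → All (_≤ l) (levels l K)
  levels-≤ l K = All.concat⁺ (All.map⁺ (All.applyUpTo⁺₁ id l (λ i<l → All.replicate⁺ K i<l)))

  take-levels : ∀ {l L} K {m} → l ≤ L → m ≤ K * l → take m (levels L K) ≡ take m (levels l K)
  take-levels {l} {L} K {m} l≤L m≤Kl = begin
    take m (levels L K)
      ≡⟨ cong (λ k → take k (levels L K)) (ℕ.m≤n⇒m⊓n≡m m≤Kl) ⟨
    take (m ℕ.⊓ (K * l)) (levels L K)
      ≡⟨ List.take-take m (K * l) (levels L K) ⟨
    take m (take (K * l) (levels L K))
      ≡⟨ cong (take m) (trans (take-blocks K l (upTo L)) (cong (blocks K) (take-applyUpTo id l≤L))) ⟩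
    take m (levels l K) ∎
    where open ≡-Reasoning

module WeightProducts (l : ℕ) where
  open import Data.Rational using (ℚ; 0ℚ; 1ℚ; _+_; _*_; _≤_)
  open Arithmetic
  open LevelWeights l
  open Levels
  open +-*-Solver

  partialProduct : ℕ → ℚ
  partialProduct m = prodℚ (map (weight ∘ suc) (upTo m))

  partialProduct-suc : ∀ m → partialProduct (suc m) ≡ partialProduct m * weight (suc m)
  partialProduct-suc m = begin
    prodℚ (map (weight ∘ suc) (upTo (suc m)))
      ≡⟨ cong (prodℚ ∘ map (weight ∘ suc)) (List.upTo-∷ʳ m) ⟨
    prodℚ (map (weight ∘ suc) (upTo m ++ [ m ]))
      ≡⟨ cong prodℚ (List.map-++ (weight ∘ suc) (upTo m) [ m ]) ⟩
    prodℚ (map (weight ∘ suc) (upTo m) ++ [ weight (suc m) ])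
      ≡⟨ prodℚ-++ (map (weight ∘ suc) (upTo m)) [ weight (suc m) ] ⟩
    partialProduct m * (weight (suc m) * 1ℚ)
      ≡⟨ cong (partialProduct m *_) (ℚ.*-identityʳ _) ⟩
    partialProduct m * weight (suc m) ∎
    where open ≡-Reasoning

  partialProduct-≤ : ∀ m → suc m ℕ.≤ l → partialProduct m ≤ 1ℚ + four * (powℚ two m * h)
  partialProduct-≤ zero    _      = 1≤1+x (*-0≤ (*-0≤ 0≤two 0≤two) (*-0≤ 0≤1 0≤h))
  partialProduct-≤ (suc m) m+2≤l = begin
    partialProduct (suc m)
      ≡⟨ partialProduct-suc m ⟩
    partialProduct m * weight (suc m)
      ≤⟨ *-mono-≤-0≤ (ℚ.≤-trans 0≤1 (1≤1+x (*-0≤ (*-0≤ 0≤two 0≤two) 0≤y))) (ℚ.≤-trans 0≤1 (1≤weight (suc m)))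
                     (partialProduct-≤ m (ℕ.<⇒≤ m+2≤l)) (ℚ.≤-reflexive (cong (1ℚ +_) (ℚ.*-assoc two (powℚ two m) h))) ⟩
    (1ℚ + four * y) * (1ℚ + two * y)
      ≤⟨ [1+4y][1+2y]≤1+8y 0≤y 4y≤1 ⟩
    1ℚ + four * (two * y)
      ≡⟨ cong (λ z → 1ℚ + four * z) (ℚ.*-assoc two (powℚ two m) h) ⟨
    1ℚ + four * (powℚ two (suc m) * h) ∎
    where
    open ℚ.≤-Reasoning
    y = powℚ two m * h
    0≤y : 0ℚ ≤ y
    0≤y = *-0≤ (powℚ-0≤ m 0≤two) 0≤h
    4y≤1 : four * y ≤ 1ℚ
    4y≤1 = ℚ.≤-trans (ℚ.≤-reflexive (solve 3 (λ t p h → (t :* t) :* (p :* h) := (t :* (t :* p)) :* h) refl two (powℚ two m) h))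
                     (2^e*½^l≤1 m+2≤l)

  partialProduct-≤8 : ∀ {l′} → l ≡ suc l′ → partialProduct l ≤ eight
  partialProduct-≤8 {l′} refl = begin
    partialProduct (suc l′)
      ≡⟨ partialProduct-suc l′ ⟩
    partialProduct l′ * weight (suc l′)
      ≤⟨ *-monoʳ-≤-0≤ (ℚ.≤-trans 0≤1 (1≤weight (suc l′))) (partialProduct-≤ l′ ℕ.≤-refl) ⟩
    (1ℚ + four * (powℚ two l′ * h)) * weight (suc l′)
      ≡⟨ cong₂ (λ a b → (1ℚ + a) * (1ℚ + b))
               (trans (solve 3 (λ t p h → (t :* t) :* (p :* h) := t :* ((t :* p) :* h)) refl two (powℚ two l′) h)
                      (trans (cong (two *_) 2^l*h≡1) (ℚ.*-identityʳ two)))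
               2^l*h≡1 ⟩
    (1ℚ + two) * (1ℚ + 1ℚ)
      ≤⟨ ℚ.≤ᵇ⇒≤ tt ⟩
    eight ∎
    where
    open ℚ.≤-Reasoning
    2^l*h≡1 : powℚ two (suc l′) * h ≡ 1ℚ
    2^l*h≡1 = trans (ℚ.*-comm (powℚ two (suc l′)) h) (½^e*2^e≡1 (suc l′))

  prodℚ-blocks : ∀ K xs → prodℚ (map weight (blocks K xs)) ≡ powℚ (prodℚ (map (weight ∘ suc) xs)) K
  prodℚ-blocks K []       = sym (powℚ-1ℚ K)
  prodℚ-blocks K (x ∷ xs) = begin
    prodℚ (map weight (replicate K (suc x) ++ blocks K xs))
      ≡⟨ cong prodℚ (List.map-++ weight (replicate K (suc x)) (blocks K xs)) ⟩
    prodℚ (map weight (replicate K (suc x)) ++ map weight (blocks K xs))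
      ≡⟨ prodℚ-++ (map weight (replicate K (suc x))) _ ⟩
    prodℚ (map weight (replicate K (suc x))) * prodℚ (map weight (blocks K xs))
      ≡⟨ cong₂ _*_ (trans (cong prodℚ (List.map-replicate weight K (suc x))) (prodℚ-replicate K _)) (prodℚ-blocks K xs) ⟩
    powℚ (weight (suc x)) K * powℚ (prodℚ (map (weight ∘ suc) xs)) K
      ≡⟨ powℚ-distrib-* (weight (suc x)) _ K ⟨
    powℚ (weight (suc x) * prodℚ (map (weight ∘ suc) xs)) K ∎
    where open ≡-Reasoning

  prodℚ-levels-≤ : 1 ℕ.≤ l → ∀ K → prodℚ (map weight (levels l K)) ≤ powℚ eight K
  prodℚ-levels-≤ 1≤l K = begin
    prodℚ (map weight (levels l K))
      ≡⟨ prodℚ-blocks K (upTo l) ⟩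
    powℚ (partialProduct l) K
      ≤⟨ powℚ-monoˡ-≤ K 0≤partialProduct (partialProduct-≤8 (sym (ℕ.suc-pred l {{ℕ.>-nonZero 1≤l}}))) ⟩
    powℚ eight K ∎
    where
    open ℚ.≤-Reasoning
    0≤partialProduct : 0ℚ ≤ partialProduct l
    0≤partialProduct = ℚ.≤-trans 0≤1 (1≤prodℚ (All.map⁺ {xs = upTo l} (tabulate (λ {i} _ → 1≤weight (suc i)))))

module TailBound where
  open import Data.Rational using (0ℚ; 1ℚ; ½; _+_; _*_; _≤_; positive)
  import Data.Nat.Solver as ℕ-Solver
  open Arithmetic
  open Expectation
  open LevelWeights
  open Levels
  open WeightProducts
  open +-*-Solver

  bitProbs-probabilities : ∀ L K m → Probabilities (bitProbs L K m)
  bitProbs-probabilities L K m = All.concat⁺ (All.replicate⁺ m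
    (subst Probabilities (sym (bitProbsEdge≡ L K)) (½^-probabilities (levels L K))))

  two≤growth^2^[1+l] : ∀ l → two ≤ powℚ (growth l) (2 ^ suc l)
  two≤growth^2^[1+l] l = ℚ.≤-trans (ℚ.≤-reflexive (cong (1ℚ +_) (sym 2^[1+l]*[h*½]≡1)))
                                   (bernoulli-pow2 (suc l) (*-0≤ (0≤h l) 0≤½))
    where
    2^[1+l]*[h*½]≡1 : powℚ two (suc l) * (h l * ½) ≡ 1ℚ
    2^[1+l]*[h*½]≡1 = trans (solve 4 (λ t T H h → (t :* T) :* (H :* h) := (h :* t) :* (H :* T)) refl two (powℚ two l) (h l) ½)
                            (cong ((½ * two) *_) (½^e*2^e≡1 l))

  2^[4Kn]≤growth^[8K2^ln] : ∀ l K n → powℚ two (4 ℕ.* (K ℕ.* n)) ≤ powℚ (growth l) (8 ℕ.* K ℕ.* 2 ^ l ℕ.* n)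
  2^[4Kn]≤growth^[8K2^ln] l K n = begin
    powℚ two (4 ℕ.* (K ℕ.* n))                            ≤⟨ powℚ-monoˡ-≤ (4 ℕ.* (K ℕ.* n)) 0≤two (two≤growth^2^[1+l] l) ⟩
    powℚ (powℚ (growth l) (2 ^ suc l)) (4 ℕ.* (K ℕ.* n))  ≡⟨ powℚ-* (growth l) (2 ^ suc l) (4 ℕ.* (K ℕ.* n)) ⟨
    powℚ (growth l) (2 ^ suc l ℕ.* (4 ℕ.* (K ℕ.* n)))     ≡⟨ cong (powℚ (growth l)) (exponent K (2 ^ l) n) ⟩
    powℚ (growth l) (8 ℕ.* K ℕ.* 2 ^ l ℕ.* n)             ∎
    where
    open ℚ.≤-Reasoning
    open ℕ-Solver.+-*-Solver using () renaming (solve to solveℕ; _:*_ to _⊛_; _:=_ to _≐_; con to cst)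
    exponent : ∀ K p n → (2 ℕ.* p) ℕ.* (4 ℕ.* (K ℕ.* n)) ≡ 8 ℕ.* K ℕ.* p ℕ.* n
    exponent = solveℕ 3 (λ K p n → (cst 2 ⊛ p) ⊛ (cst 4 ⊛ (K ⊛ n)) ≐ cst 8 ⊛ K ⊛ p ⊛ n) refl

  initial-potential-≤ : ∀ {n l L} K J → 1 ℕ.≤ l → l ℕ.≤ L → J ∸ 1 ℕ.≤ K ℕ.* l →
    Supermartingale.Φ {n} l J (levels L K) initState ≤ powℚ two (3 ℕ.* (K ℕ.* n))
  initial-potential-≤ {n} {l} {L} K J 1≤l l≤L J≤Kl = begin
    potential 1 ws initState
      ≡⟨ potential-initState 1 ws ⟩
    powℚ (prodℚ ws) n
      ≤⟨ powℚ-monoˡ-≤ n (ℚ.≤-trans 0≤1 (1≤prodℚ (1≤weights l (take (J ∸ 1) (levels L K))))) prodℚ-ws-≤ ⟩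
    powℚ (powℚ eight K) n
      ≡⟨ trans (powℚ-* two (3 ℕ.* K) n) (cong (λ x → powℚ x n) (powℚ-* two 3 K)) ⟨
    powℚ two (3 ℕ.* K ℕ.* n)
      ≡⟨ cong (powℚ two) (ℕ.*-assoc 3 K n) ⟩
    powℚ two (3 ℕ.* (K ℕ.* n)) ∎
    where
    open ℚ.≤-Reasoning
    open Potential {n}
    ws = map (weight l) (take (J ∸ 1) (levels L K))
    prodℚ-ws-≤ : prodℚ ws ≤ powℚ eight K
    prodℚ-ws-≤ = begin
      prodℚ (map (weight l) (take (J ∸ 1) (levels L K)))  ≡⟨ cong (prodℚ ∘ map (weight l)) (take-levels K l≤L J≤Kl) ⟩
      prodℚ (map (weight l) (take (J ∸ 1) (levels l K)))  ≡⟨ cong prodℚ (List.take-map (J ∸ 1) (levels l K)) ⟨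
      prodℚ (take (J ∸ 1) (map (weight l) (levels l K)))  ≤⟨ prodℚ-take-≤ (J ∸ 1) (1≤weights l (levels l K)) ⟩
      prodℚ (map (weight l) (levels l K))                 ≤⟨ prodℚ-levels-≤ l 1≤l K ⟩
      powℚ eight K                                        ∎

  index≤Kl : ∀ K {l k} → 1 ℕ.≤ l → k ℕ.≤ K → K ℕ.* (l ∸ 1) ℕ.+ k ∸ 1 ℕ.≤ K ℕ.* l
  index≤Kl K {suc l} {k} _ k≤K = begin
    K ℕ.* l ℕ.+ k ∸ 1          ≤⟨ ℕ.m∸n≤m _ 1 ⟩
    K ℕ.* l ℕ.+ k              ≤⟨ ℕ.+-monoʳ-≤ (K ℕ.* l) k≤K ⟩
    K ℕ.* l ℕ.+ K              ≡⟨ ℕ.+-comm _ K ⟩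
    K ℕ.+ K ℕ.* l              ≡⟨ ℕ.*-suc K l ⟨
    K ℕ.* suc l                ∎
    where open ℕ.≤-Reasoning

  failProb-bound : ∀ {n K l k} es → 1 ℕ.≤ l → l ℕ.≤ Lparam n → k ℕ.≤ K →
                   failProb n K 8 l k es * powℚ two (K ℕ.* n) ≤ 1ℚ
  failProb-bound {n} {K} {l} {k} es 1≤l l≤L k≤K =
    ℚ.*-cancelˡ-≤-pos (powℚ two (3 ℕ.* t)) {{positive 0<2^3t}} (begin
      powℚ two (3 ℕ.* t) * (fp * powℚ two t)
        ≡⟨ solve 3 (λ a f b → a :* (f :* b) := f :* (b :* a)) refl (powℚ two (3 ℕ.* t)) fp (powℚ two t) ⟩
      fp * (powℚ two t * powℚ two (3 ℕ.* t))
        ≡⟨ cong (fp *_) (powℚ-+ two t (3 ℕ.* t)) ⟨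
      fp * powℚ two (4 ℕ.* t)
        ≤⟨ *-monoˡ-≤-0≤ 0≤fp (2^[4Kn]≤growth^[8K2^ln] l K n) ⟩
      fp * powℚ (growth l) B
        ≤⟨ *-monoˡ-≤-0≤ 0≤fp (powℚ-monoʳ-≤ (1≤growth l) (ℕ.n≤1+n B)) ⟩
      fp * powℚ (growth l) (suc B)
        ≤⟨ markov count B probabilities (1≤growth l) ⟩
      Ex ps (λ bs → powℚ (growth l) (count bs))
        ≤⟨ stream-supermartingale L K (bitProbsEdge≡ L K) (length-levels L K) J∸1≤LK bounded
                                  es initState (Labelling.initState-canonical {n}) ⟩
      Φ initState
        ≤⟨ initial-potential-≤ K J 1≤l l≤L J∸1≤Kl ⟩
      powℚ two (3 ℕ.* t)
        ≡⟨ ℚ.*-identityʳ _ ⟨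
      powℚ two (3 ℕ.* t) * 1ℚ ∎)
    where
    open ℚ.≤-Reasoning
    L = Lparam n
    J = K ℕ.* (l ∸ 1) ℕ.+ k
    open Supermartingale {n} l J (levels L K) using (Φ; stream-supermartingale)
    t = K ℕ.* n
    B = 8 ℕ.* K ℕ.* 2 ^ l ℕ.* n
    ps = bitProbs L K (length es)
    count = countNotX (L ℕ.* K) J initState es
    fp = failProb n K 8 l k es
    0<2^3t : 0ℚ ℚ.< powℚ two (3 ℕ.* t)
    0<2^3t = ℚ.<-≤-trans (ℚ.positive⁻¹ 1ℚ) (powℚ-1≤ (3 ℕ.* t) 1≤two)
    probabilities : Probabilities ps
    probabilities = bitProbs-probabilities L K (length es)
    0≤fp : 0ℚ ≤ fp
    0≤fp = Pr-0≤ _ probabilities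
    J∸1≤Kl : J ∸ 1 ℕ.≤ K ℕ.* l
    J∸1≤Kl = index≤Kl K 1≤l k≤K
    J∸1≤LK : J ∸ 1 ℕ.≤ L ℕ.* K
    J∸1≤LK = ℕ.≤-trans J∸1≤Kl (ℕ.≤-trans (ℕ.*-monoʳ-≤ K l≤L) (ℕ.≤-reflexive (ℕ.*-comm K L)))
    bounded : All (ℕ._≤ l) (take (J ∸ 1) (levels L K))
    bounded = subst (All (ℕ._≤ l)) (sym (take-levels K l≤L J∸1≤Kl)) (All.take⁺ (J ∸ 1) (levels-≤ l K))

  failProb*n≤1 : ∀ {n K l k} es → 1 ℕ.≤ K → 1 ℕ.≤ l → l ℕ.≤ Lparam n → k ℕ.≤ K →
                 failProb n K 8 l k es * ofℕ n ≤ 1ℚ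
  failProb*n≤1 {n} {K} {l} {k} es 1≤K 1≤l l≤L k≤K = begin
    failProb n K 8 l k es * ofℕ n
      ≤⟨ *-monoˡ-≤-0≤ (Pr-0≤ _ (bitProbs-probabilities (Lparam n) K (length es))) n≤2^Kn ⟩
    failProb n K 8 l k es * powℚ two (K ℕ.* n) ≤⟨ failProb-bound es 1≤l l≤L k≤K ⟩
    1ℚ ∎
    where
    open ℚ.≤-Reasoning
    n≤2^Kn : ofℕ n ≤ powℚ two (K ℕ.* n)
    n≤2^Kn = ℚ.≤-trans (ofℕ≤2^ n) (powℚ-monoʳ-≤ 1≤two (ℕ.m≤n*m n K {{ℕ.>-nonZero 1≤K}}))

open import Data.Nat using (_≤_)
open import Data.Rational using (1ℚ)

mainTheorem8 : Σ ℕ λ q → Σ ℕ λ C → Σ ℕ λ N →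
    (n : ℕ) → N ≤ n → (K : ℕ) → 1 ≤ K →
    (es : List (Edge n)) → SimpleStream es →
    (l k : ℕ) → 1 ≤ l → l ≤ Lparam n → 1 ≤ k → k ≤ K →
    (powℚ (failProb n K C l k es) (suc q) ℚ.* ofℕ n) ℚ.≤ 1ℚ
mainTheorem8 = 0 , 8 , 0 , λ n _ K 1≤K es _ l k 1≤l l≤L _ k≤K →
  ℚ.≤-trans (ℚ.≤-reflexive (cong (ℚ._* ofℕ n) (ℚ.*-identityʳ (failProb n K 8 l k es))))
            (TailBound.failProb*n≤1 es 1≤K 1≤l l≤L k≤K)
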